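{- Consider augmentations $\mathfrak q, \mathfrak p$ on $A$ where $\mathfrak p$ is a causal strategy and $\mathfrak q \in \mathrm{Exp}(\mathfrak p)$ is a $-$-obsessional expansion with the morphism $\varphi : \mathfrak q\to\mathfrak p$. Then, for all $a\in|\mathfrak q|$, $a \sim_{\Gamma\langle a\rangle} \varphi(a)$, where $\Gamma\langle a\rangle : [a]^-_{\mathfrak q}\cong[\varphi(a)]^-_{\mathfrak p}$ is the order-isomorphism induced by $\varphi$, with $[a]^-_{\mathfrak q}=\{a'\le_{\mathfrak q}a\mid\lambda(a')=-\}$.
   Context: $A$ well-opened arena; $\prec$ denotes immediate causality in any order. Augmentation $\mathfrak q$: events $|\mathfrak q|$, configuration $D(\mathfrak q)=(|\mathfrak q|,\le_{D(\mathfrak q)},\partial_{\mathfrak q})$, tree order $\le_{\mathfrak q}$, rule-abiding, courteous (if $a_1\prec_{\mathfrak q}a_2$ with $\lambda(a_1)=+$ or $\lambda(a_2)=-$ then $a_1\prec_{D(\mathfrak q)}a_2$), deterministic; $\mathrm{just}(a)$ is the unique $a''\prec_{D(\mathfrak q)}a$. Causal strategy: receptive and $-$-linear. Morphism: preserves $\partial$, $\prec_{\mathfrak q}$, $\prec_{D(\mathfrak q)}$. Expansion: morphism $\varphi:\mathfrak q\to\mathfrak p$ that is $+$-obsessional (for $a^-$, $\varphi(a)\prec_{\mathfrak p}b^+$ there is $a\prec_{\mathfrak q}a'$ with $\varphi(a')=b$); $-$-obsessional: for $a^+$ with $\partial(a)\prec_A b^-$ there is $a\prec_{\mathfrak q}a'$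 with $\partial(a')=b$. A context $\Gamma$ is a display-preserving bijection from negative events of $\mathfrak q$ to events of $\mathfrak p$; $\Gamma\vdash(a,b)$: no element of $\mathrm{dom}(\Gamma)$ strictly above $a$, none of $\mathrm{cod}(\Gamma)$ strictly above $b$. $a\sim_\Gamma b$ holds inductively if (a) $\partial_{\mathfrak q}(a)=\partial_{\mathfrak p}(b)$ and $\Gamma\vdash(a,b)$; (b) if $a$ positive, $\mathrm{just}(a)\in\mathrm{dom}(\Gamma)$ and $\Gamma(\mathrm{just}(a))=\mathrm{just}(b)$; (1) if $a$ positive and $a\prec_{\mathfrak q}a'$ there is $b\prec_{\mathfrak p}b'$ with $a'\sim_{\Gamma\cup\{(a',b')\}}b'$, and symmetrically; (2) if $a$ negative and $a\prec_{\mathfrak q}a'$ there is $b\prec_{\mathfrak p}b'$ with $a'\sim_\Gamma b'$, and symmetrically. -}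

module Defs where

open import Level using (Level; suc; _⊔_)
open import Data.Nat using (ℕ) renaming (suc to sucℕ)
open import Data.Maybe using (Maybe; just; nothing)
open import Data.Product using (Σ; Σ-syntax; ∃; ∃-syntax; _×_; _,_)
open import Data.Sum using (_⊎_; inj₁; inj₂)
open import Data.List using (List)
open import Data.List.Membership.Propositional using (_∈_)
open import Relation.Nullary using (¬_)
open import Relation.Binary.PropositionalEquality using (_≡_; _≢_)
open import Relation.Binary.Construct.Closure.ReflexiveTransitive using (Star)
open import Relation.Binary.Construct.Closure.Transitive using (TransClosure)

data Pol : Set where
  ⁻ ⁺ : Pol

-- A (countable) forest order ≤ on a set X in which every element has
-- finitely many predecessors is the same thing as a parent map
-- par : X → Maybe X without infinite descending parent chains; the
-- depth function witnesses the latter.  ≤ is the reflexive-transitive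
-- closure of immediate causality  x ≺ y  :=  par y ≡ just x.

record IsForest {X : Set} (par : X → Maybe X) : Set where
  field
    depth     : X → ℕ
    depth-par : ∀ {x y} → par y ≡ just x → depth y ≡ sucℕ (depth x)

module ForestOrder {X : Set} (par : X → Maybe X) where
  _≺_ : X → X → Set
  x ≺ y = par y ≡ just x

  _≤_ : X → X → Set
  _≤_ = Star _≺_

  _<_ : X → X → Set
  _<_ = TransClosure _≺_

  Minimal : X → Set
  Minimal x = par x ≡ nothing

record Arena : Set₁ where
  field
    M      : Set
    par    : M → Maybe M
    forest : IsForest par
    pol    : M → Pol
    alternating : ∀ {m n} → par n ≡ just m → pol m ≢ pol n
    minimal-neg : ∀ {m} → par m ≡ nothing → pol m ≡ ⁻
  open ForestOrder par public

WellOpened : Arena → Set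
WellOpened A = Σ[ m ∈ M ] (Minimal m × (∀ m' → Minimal m' → m' ≡ m))
  where open Arena A

-- E         : events |q|
-- ∂         : display map ∂_q
-- jpar      : immediate predecessor in ≤_{D(q)}  (justifier)
-- cpar      : immediate predecessor in the tree order ≤_q

record Aug (A : Arena) : Set₁ where
  open Arena A using (M) renaming (par to parA; pol to polA)
  field
    E    : Set
    ∂    : E → M
    jpar : E → Maybe E
    cpar : E → Maybe E
    D-forest : IsForest jpar
    q-forest : IsForest cpar

  module D = ForestOrder jpar
  module C = ForestOrder cpar

  λ' : E → Pol
  λ' e = polA (∂ e)

  field
    -- D(q) is a configuration of A: ∂ preserves minimality and ≺
    ∂-minimal   : ∀ e → (jpar e ≡ nothing → parA (∂ e) ≡ nothing)
                      × (parA (∂ e) ≡ nothing → jpar e ≡ nothing)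
    ∂-≺         : ∀ {e e'} → e D.≺ e' → parA (∂ e') ≡ just (∂ e)
    rule-abiding : ∀ {e e'} → e D.≤ e' → e C.≤ e'
    courteous    : ∀ {e e'} → e C.≺ e' → (λ' e ≡ ⁺ ⊎ λ' e' ≡ ⁻) → e D.≺ e'
    deterministic : ∀ {e e₁ e₂} → λ' e ≡ ⁻ → λ' e₁ ≡ ⁺ → λ' e₂ ≡ ⁺
                    → e C.≺ e₁ → e C.≺ e₂ → e₁ ≡ e₂

module _ {A : Arena} where
  open Arena A using () renaming (par to parA; Minimal to MinimalA)

  IsFinite : Aug A → Set
  IsFinite q = Σ[ l ∈ List E ] (∀ e → e ∈ l)
    where open Aug q

  Receptive : Aug A → Set
  Receptive p =
      (∀ m → MinimalA m → Σ[ b ∈ E ] (C.Minimal b × ∂ b ≡ m))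
    × (∀ b m → λ' b ≡ ⁺ → parA m ≡ just (∂ b)
         → Σ[ b' ∈ E ] (b C.≺ b' × ∂ b' ≡ m))
    where open Aug p

  MinusLinear : Aug A → Set
  MinusLinear p =
      (∀ b₁ b₂ → C.Minimal b₁ → C.Minimal b₂ → ∂ b₁ ≡ ∂ b₂ → b₁ ≡ b₂)
    × (∀ b b₁ b₂ → λ' b₁ ≡ ⁻ → λ' b₂ ≡ ⁻ → b C.≺ b₁ → b C.≺ b₂
         → ∂ b₁ ≡ ∂ b₂ → b₁ ≡ b₂)
    where open Aug p

  CausalStrategy : Aug A → Set
  CausalStrategy p = Receptive p × MinusLinear p

  MinusObsessional : Aug A → Set
  MinusObsessional q =
    ∀ a m → λ' a ≡ ⁺ → parA m ≡ just (∂ a)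
      → Σ[ a' ∈ E ] (a C.≺ a' × ∂ a' ≡ m)
    where open Aug q

  record Morphism (q p : Aug A) : Set where
    private
      module Q = Aug q
      module P = Aug p
    field
      fun     : Q.E → P.E
      pres-∂  : ∀ a → P.∂ (fun a) ≡ Q.∂ a
      pres-≺C : ∀ {a a'} → a Q.C.≺ a' → fun a P.C.≺ fun a'
      pres-≺D : ∀ {a a'} → a Q.D.≺ a' → fun a P.D.≺ fun a'

  IsExpansion : {q p : Aug A} → Morphism q p → Set
  IsExpansion {q} {p} φ =
    ∀ a b → Q.λ' a ≡ ⁻ → P.λ' b ≡ ⁺ → fun a P.C.≺ b
      → Σ[ a' ∈ Q.E ] (a Q.C.≺ a' × fun a' ≡ b)
    where
      module Q = Aug q
      module P = Aug p
      open Morphism φ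

  module _ (q p : Aug A) where
    private
      module Q = Aug q
      module P = Aug p

    Ctx : Set₁
    Ctx = Q.E → P.E → Set

    extend : Ctx → Q.E → P.E → Ctx
    extend Γ a b x y = Γ x y ⊎ (x ≡ a × y ≡ b)

    _⊢_,_ : Ctx → Q.E → P.E → Set
    Γ ⊢ a , b = (∀ x y → Γ x y → ¬ (a Q.C.< x))
              × (∀ x y → Γ x y → ¬ (b P.C.< y))

    data Sim : Ctx → Q.E → P.E → Set₁ where
      sim : ∀ {Γ a b}
        → Q.∂ a ≡ P.∂ b
        → Γ ⊢ a , b
        → (Q.λ' a ≡ ⁺ → Σ[ a'' ∈ Q.E ] Σ[ b'' ∈ P.E ]
              (a'' Q.D.≺ a × b'' P.D.≺ b × Γ a'' b''))
        → (Q.λ' a ≡ ⁺ →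
              (∀ a' → a Q.C.≺ a' → Σ[ b' ∈ P.E ] (b P.C.≺ b' × Sim (extend Γ a' b') a' b'))
            × (∀ b' → b P.C.≺ b' → Σ[ a' ∈ Q.E ] (a Q.C.≺ a' × Sim (extend Γ a' b') a' b')))
        → (Q.λ' a ≡ ⁻ →
              (∀ a' → a Q.C.≺ a' → Σ[ b' ∈ P.E ] (b P.C.≺ b' × Sim Γ a' b'))
            × (∀ b' → b P.C.≺ b' → Σ[ a' ∈ Q.E ] (a Q.C.≺ a' × Sim Γ a' b')))
        → Sim Γ a b

  Γ⟨_,_⟩ : {q p : Aug A} (φ : Morphism q p) → Aug.E q → Ctx q p
  Γ⟨_,_⟩ {q} φ a x y = (x Q.C.≤ a) × (Q.λ' x ≡ ⁻) × (Morphism.fun φ x ≡ y)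
    where module Q = Aug q

{-# OPTIONS --safe #-}
module Submission where

-- Induction upwards along the tree order of q, which is well-founded because q is finite.
-- φ matches the children of a with those of φ(a): for negative a every child of φ(a) is
-- reached by +-obsessionality of φ; for positive a, −-obsessionality of q yields a child
-- a' with the same display as a given child b' of φ(a), and −-linearity of p gives
-- φ(a') = b'.  For a child a' of a, Γ⟨a'⟩ is Γ⟨a⟩ when a' is positive and
-- Γ⟨a⟩ ∪ {(a', φ(a'))} when a' is negative, as the clauses (2) and (1) demand.

open import Defs
open import Function using (flip)
open import Data.Nat as ℕ using (ℕ; _∸_)
open import Data.Nat.Properties using (≤-refl; ≤-reflexive; <⇒≤; <-irrefl; <-trans; ≤-<-trans; <-≤-trans; ∸-monoʳ-<)
open import Data.Nat.Induction using (<-wellFounded)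
open import Data.Maybe using (Maybe; just; nothing)
open import Data.Maybe.Properties using (just-injective)
open import Data.Product using (Σ-syntax; _×_; _,_; proj₁; proj₂; swap)
open import Data.Sum as Sum using (_⊎_; inj₁; inj₂)
open import Data.Empty using (⊥-elim)
open import Data.List using (List; map)
open import Data.List.Membership.Propositional using (_∈_)
open import Data.List.Membership.Propositional.Properties using (∈-map⁺)
open import Data.List.Relation.Unary.All as All using ()
open import Data.List.Extrema.Nat using (max; xs≤max)
open import Relation.Nullary using (¬_)
open import Relation.Binary.Core using (_⇔_)
open import Relation.Binary.PropositionalEquality using (_≡_; _≢_; refl; sym; trans; cong; subst)
open import Relation.Binary.Construct.Closure.ReflexiveTransitive using (ε; _◅_; _◅◅_; gmap)
open import Relation.Binary.Construct.Closure.Transitive using ([_]; _∷_)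
open import Relation.Binary.Construct.On as On using ()
open import Induction.WellFounded using (WellFounded; Acc; acc; module Subrelation)

module ForestProperties {X : Set} {par : X → Maybe X} (forest : IsForest par) where
  open ForestOrder par
  open IsForest forest

  ≺-parent-unique : ∀ {x y z} → x ≺ z → y ≺ z → x ≡ y
  ≺-parent-unique x≺z y≺z = just-injective (trans (sym x≺z) y≺z)

  ≺⇒depth< : ∀ {x y} → x ≺ y → depth x ℕ.< depth y
  ≺⇒depth< x≺y = ≤-reflexive (sym (depth-par x≺y))

  ≤⇒depth≤ : ∀ {x y} → x ≤ y → depth x ℕ.≤ depth y
  ≤⇒depth≤ ε = ≤-refl
  ≤⇒depth≤ (x≺z ◅ z≤y) = <⇒≤ (<-≤-trans (≺⇒depth< x≺z) (≤⇒depth≤ z≤y))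

  <⇒depth< : ∀ {x y} → x < y → depth x ℕ.< depth y
  <⇒depth< [ x≺y ] = ≺⇒depth< x≺y
  <⇒depth< (x≺z ∷ z<y) = <-trans (≺⇒depth< x≺z) (<⇒depth< z<y)

  ≤⇒≯ : ∀ {x y} → x ≤ y → ¬ (y < x)
  ≤⇒≯ x≤y y<x = <-irrefl refl (≤-<-trans (≤⇒depth≤ x≤y) (<⇒depth< y<x))

  ≤-≺⇒≡⊎≤ : ∀ {x y z} → x ≤ z → y ≺ z → x ≡ z ⊎ x ≤ y
  ≤-≺⇒≡⊎≤ ε y≺z = inj₁ refl
  ≤-≺⇒≡⊎≤ (x≺w ◅ w≤z) y≺z with ≤-≺⇒≡⊎≤ w≤z y≺z
  ... | inj₁ refl = inj₂ (subst (_ ≤_) (≺-parent-unique x≺w y≺z) ε)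
  ... | inj₂ w≤y  = inj₂ (x≺w ◅ w≤y)

  -- Depths are bounded on a finite forest, so the distance to the bound decreases towards the leaves.
  finite⇒children-wellFounded : (l : List X) → (∀ x → x ∈ l) → WellFounded (flip _≺_)
  finite⇒children-wellFounded l complete =
    Subrelation.wellFounded depth-gap-decreases (On.wellFounded depth-gap <-wellFounded)
    where
      bound : ℕ
      bound = max 0 (map depth l)

      depth≤bound : ∀ x → depth x ℕ.≤ bound
      depth≤bound x = All.lookup (xs≤max 0 (map depth l)) (∈-map⁺ depth (complete x))

      depth-gap : X → ℕ
      depth-gap x = bound ∸ depth x

      depth-gap-decreases : ∀ {y x} → x ≺ y → depth-gap y ℕ.< depth-gap x
      depth-gap-decreases {y} x≺y = ∸-monoʳ-< (≺⇒depth< x≺y) (depth≤bound y)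

⁺≢⁻ : ⁺ ≢ ⁻
⁺≢⁻ ()

≢⁺⇒⁻ : ∀ {x} → x ≢ ⁺ → x ≡ ⁻
≢⁺⇒⁻ {⁻} _ = refl
≢⁺⇒⁻ {⁺} x≢⁺ = ⊥-elim (x≢⁺ refl)

module AugProperties {A : Arena} (r : Aug A) where
  open Arena A using (alternating; minimal-neg)
  open Aug r

  D-alternating : ∀ {e e'} → e D.≺ e' → λ' e ≢ λ' e'
  D-alternating e≺e' = alternating (∂-≺ e≺e')

  ⁺-justified : ∀ {e} → λ' e ≡ ⁺ → Σ[ e'' ∈ E ] (e'' D.≺ e × λ' e'' ≡ ⁻)
  ⁺-justified {e} e⁺ with jpar e in jpar-e
  ... | just e'' = e'' , refl , ≢⁺⇒⁻ (λ e''⁺ → D-alternating jpar-e (trans e''⁺ (sym e⁺)))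
  ... | nothing  = ⊥-elim (⁺≢⁻ (trans (sym e⁺) (minimal-neg (proj₁ (∂-minimal e) jpar-e))))

  ⁺-child : ∀ {e e'} → λ' e ≡ ⁺ → e C.≺ e' → e D.≺ e' × λ' e' ≡ ⁻
  ⁺-child e⁺ e≺e' = e≺De' , ≢⁺⇒⁻ (λ e'⁺ → D-alternating e≺De' (trans e⁺ (sym e'⁺)))
    where
      e≺De' = courteous e≺e' (inj₁ e⁺)

  ⁻-child : ∀ {e e'} → λ' e ≡ ⁻ → e C.≺ e' → λ' e' ≡ ⁺
  ⁻-child {e' = e'} e⁻ e≺e' with λ' e' in λe'
  ... | ⁺ = refl
  ... | ⁻ = ⊥-elim (D-alternating (courteous e≺e' (inj₂ λe')) (trans e⁻ (sym λe')))

module _ {A : Arena} {q p : Aug A} where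
  private
    module Q = Aug q
    module P = Aug p

  extend-resp-⇔ : ∀ {G H : Ctx q p} a b → G ⇔ H → extend q p G a b ⇔ extend q p H a b
  extend-resp-⇔ a b (G⇒H , H⇒G) = Sum.map₁ G⇒H , Sum.map₁ H⇒G

  Sim-resp-⇔ : ∀ {G H : Ctx q p} {a b} → G ⇔ H → Sim q p G a b → Sim q p H a b
  Sim-resp-⇔ G⇔H@(G⇒H , H⇒G) (sim ∂≡ (above-a , above-b) justified positive negative) =
    sim ∂≡
        ((λ x y Hxy → above-a x y (H⇒G Hxy)) , (λ x y Hxy → above-b x y (H⇒G Hxy)))
        (λ a⁺ → let (a'' , b'' , a''≺a , b''≺b , Ga''b'') = justified a⁺
                in a'' , b'' , a''≺a , b''≺b , G⇒H Ga''b'')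
        (λ a⁺ → (λ a' a≺a' → let (b' , b≺b' , S) = proj₁ (positive a⁺) a' a≺a'
                             in b' , b≺b' , Sim-resp-⇔ (extend-resp-⇔ a' b' G⇔H) S)
              , (λ b' b≺b' → let (a' , a≺a' , S) = proj₂ (positive a⁺) b' b≺b'
                             in a' , a≺a' , Sim-resp-⇔ (extend-resp-⇔ a' b' G⇔H) S))
        (λ a⁻ → (λ a' a≺a' → let (b' , b≺b' , S) = proj₁ (negative a⁻) a' a≺a'
                             in b' , b≺b' , Sim-resp-⇔ G⇔H S)
              , (λ b' b≺b' → let (a' , a≺a' , S) = proj₂ (negative a⁻) b' b≺b'
                             in a' , a≺a' , Sim-resp-⇔ G⇔H S))

module _ {A : Arena} {q p : Aug A} (φ : Morphism q p) where
  private
    module Q = Aug q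
    module P = Aug p
    module QF = ForestProperties Q.q-forest
    module PF = ForestProperties P.q-forest
    module QA = AugProperties q
    module PA = AugProperties p
  open Arena A using (pol)
  open Morphism φ renaming (fun to f)

  pres-λ' : ∀ a → P.λ' (f a) ≡ Q.λ' a
  pres-λ' a = cong pol (pres-∂ a)

  pres-≤C : ∀ {a a'} → a Q.C.≤ a' → f a P.C.≤ f a'
  pres-≤C = gmap f pres-≺C

  Γ⟨⟩⊢ : ∀ a → _⊢_,_ q p Γ⟨ φ , a ⟩ a (f a)
  Γ⟨⟩⊢ a = (λ { x y (x≤a , _ , _) → QF.≤⇒≯ x≤a })
         , (λ { x y (x≤a , _ , refl) → PF.≤⇒≯ (pres-≤C x≤a) })

  Γ⟨⟩-justifier : ∀ {a a''} → a'' Q.D.≺ a → Q.λ' a'' ≡ ⁻ → Γ⟨ φ , a ⟩ a'' (f a'')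
  Γ⟨⟩-justifier a''≺a a''⁻ = Q.rule-abiding (a''≺a ◅ ε) , a''⁻ , refl

  Γ⟨⟩-⁺-child : ∀ {a a'} → Q.λ' a ≡ ⁺ → a Q.C.≺ a'
              → extend q p Γ⟨ φ , a ⟩ a' (f a') ⇔ Γ⟨ φ , a' ⟩
  Γ⟨⟩-⁺-child {a} {a'} a⁺ a≺a' = extended⇒Γ⟨a'⟩ , Γ⟨a'⟩⇒extended
    where
      extended⇒Γ⟨a'⟩ : ∀ {x y} → extend q p Γ⟨ φ , a ⟩ a' (f a') x y → Γ⟨ φ , a' ⟩ x y
      extended⇒Γ⟨a'⟩ (inj₁ (x≤a , x⁻ , fx≡y)) = x≤a ◅◅ (a≺a' ◅ ε) , x⁻ , fx≡y
      extended⇒Γ⟨a'⟩ (inj₂ (refl , refl))    = ε , proj₂ (QA.⁺-child a⁺ a≺a') , refl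

      Γ⟨a'⟩⇒extended : ∀ {x y} → Γ⟨ φ , a' ⟩ x y → extend q p Γ⟨ φ , a ⟩ a' (f a') x y
      Γ⟨a'⟩⇒extended (x≤a' , x⁻ , fx≡y) with QF.≤-≺⇒≡⊎≤ x≤a' a≺a'
      ... | inj₁ refl = inj₂ (refl , sym fx≡y)
      ... | inj₂ x≤a  = inj₁ (x≤a , x⁻ , fx≡y)

  -- The only event below a' but not below a is a' itself, which is positive.
  Γ⟨⟩-⁻-child : ∀ {a a'} → Q.λ' a ≡ ⁻ → a Q.C.≺ a' → Γ⟨ φ , a ⟩ ⇔ Γ⟨ φ , a' ⟩
  Γ⟨⟩-⁻-child {a} {a'} a⁻ a≺a' = Γ⟨a⟩⇒Γ⟨a'⟩ , Γ⟨a'⟩⇒Γ⟨a⟩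
    where
      Γ⟨a⟩⇒Γ⟨a'⟩ : ∀ {x y} → Γ⟨ φ , a ⟩ x y → Γ⟨ φ , a' ⟩ x y
      Γ⟨a⟩⇒Γ⟨a'⟩ (x≤a , x⁻ , fx≡y) = x≤a ◅◅ (a≺a' ◅ ε) , x⁻ , fx≡y

      Γ⟨a'⟩⇒Γ⟨a⟩ : ∀ {x y} → Γ⟨ φ , a' ⟩ x y → Γ⟨ φ , a ⟩ x y
      Γ⟨a'⟩⇒Γ⟨a⟩ (x≤a' , x⁻ , fx≡y) with QF.≤-≺⇒≡⊎≤ x≤a' a≺a'
      ... | inj₁ refl = ⊥-elim (⁺≢⁻ (trans (sym (QA.⁻-child a⁻ a≺a')) x⁻))
      ... | inj₂ x≤a  = x≤a , x⁻ , fx≡y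

  sim-along-expansion : MinusLinear p → IsExpansion φ → MinusObsessional q
                      → ∀ a → Acc (flip Q.C._≺_) a → Sim q p Γ⟨ φ , a ⟩ a (f a)
  sim-along-expansion −-linear expansion obsessional a (acc below) =
    sim (sym (pres-∂ a)) (Γ⟨⟩⊢ a) justified positive negative
    where
      IH : ∀ {a'} → a Q.C.≺ a' → Sim q p Γ⟨ φ , a' ⟩ a' (f a')
      IH a≺a' = sim-along-expansion −-linear expansion obsessional _ (below a≺a')

      justified : Q.λ' a ≡ ⁺ → Σ[ a'' ∈ Q.E ] Σ[ b'' ∈ P.E ]
                    (a'' Q.D.≺ a × b'' P.D.≺ f a × Γ⟨ φ , a ⟩ a'' b'')
      justified a⁺ with QA.⁺-justified a⁺
      ... | a'' , a''≺a , a''⁻ = a'' , f a'' , a''≺a , pres-≺D a''≺a , Γ⟨⟩-justifier a''≺a a''⁻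

      IH⁺ : Q.λ' a ≡ ⁺ → ∀ {a'} → a Q.C.≺ a' → Sim q p (extend q p Γ⟨ φ , a ⟩ a' (f a')) a' (f a')
      IH⁺ a⁺ a≺a' = Sim-resp-⇔ (swap (Γ⟨⟩-⁺-child a⁺ a≺a')) (IH a≺a')

      positive : Q.λ' a ≡ ⁺ →
                   (∀ a' → a Q.C.≺ a' → Σ[ b' ∈ P.E ] (f a P.C.≺ b' × Sim q p (extend q p Γ⟨ φ , a ⟩ a' b') a' b'))
                 × (∀ b' → f a P.C.≺ b' → Σ[ a' ∈ Q.E ] (a Q.C.≺ a' × Sim q p (extend q p Γ⟨ φ , a ⟩ a' b') a' b'))
      positive a⁺ = (λ a' a≺a' → f a' , pres-≺C a≺a' , IH⁺ a⁺ a≺a') , matched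
        where
          matched : ∀ b' → f a P.C.≺ b' → Σ[ a' ∈ Q.E ] (a Q.C.≺ a' × Sim q p (extend q p Γ⟨ φ , a ⟩ a' b') a' b')
          matched b' fa≺b' with PA.⁺-child (trans (pres-λ' a) a⁺) fa≺b'
          ... | fa≺Db' , b'⁻ with obsessional a (P.∂ b') a⁺ (trans (P.∂-≺ fa≺Db') (cong just (pres-∂ a)))
          ... | a' , a≺a' , ∂a'≡∂b' =
            a' , a≺a' , subst (λ b → Sim q p (extend q p Γ⟨ φ , a ⟩ a' b) a' b) fa'≡b' (IH⁺ a⁺ a≺a')
            where
              fa'≡b' : f a' ≡ b'
              fa'≡b' = proj₂ −-linear (f a) (f a') b'
                         (trans (pres-λ' a') (proj₂ (QA.⁺-child a⁺ a≺a'))) b'⁻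
                         (pres-≺C a≺a') fa≺b' (trans (pres-∂ a') ∂a'≡∂b')

      IH⁻ : Q.λ' a ≡ ⁻ → ∀ {a'} → a Q.C.≺ a' → Sim q p Γ⟨ φ , a ⟩ a' (f a')
      IH⁻ a⁻ a≺a' = Sim-resp-⇔ (swap (Γ⟨⟩-⁻-child a⁻ a≺a')) (IH a≺a')

      negative : Q.λ' a ≡ ⁻ →
                   (∀ a' → a Q.C.≺ a' → Σ[ b' ∈ P.E ] (f a P.C.≺ b' × Sim q p Γ⟨ φ , a ⟩ a' b'))
                 × (∀ b' → f a P.C.≺ b' → Σ[ a' ∈ Q.E ] (a Q.C.≺ a' × Sim q p Γ⟨ φ , a ⟩ a' b'))
      negative a⁻ = (λ a' a≺a' → f a' , pres-≺C a≺a' , IH⁻ a⁻ a≺a') , matched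
        where
          matched : ∀ b' → f a P.C.≺ b' → Σ[ a' ∈ Q.E ] (a Q.C.≺ a' × Sim q p Γ⟨ φ , a ⟩ a' b')
          matched b' fa≺b' with expansion a b' a⁻ (PA.⁻-child (trans (pres-λ' a) a⁻) fa≺b') fa≺b'
          ... | a' , a≺a' , fa'≡b' = a' , a≺a' , subst (Sim q p Γ⟨ φ , a ⟩ a') fa'≡b' (IH⁻ a⁻ a≺a')

lemma47 : (A : Arena) → WellOpened A
    → (q p : Aug A) → CausalStrategy p
    → (φ : Morphism q p) → IsFinite q → IsExpansion φ → MinusObsessional q
    → ∀ a → Sim q p (Γ⟨ φ , a ⟩) a (Morphism.fun φ a)
lemma47 A _ q p (_ , −-linear) φ (events , complete) expansion obsessional a =
  sim-along-expansion φ −-linear expansion obsessional a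
    (ForestProperties.finite⇒children-wellFounded (Aug.q-forest q) events complete a)
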